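{- Let $G$ be a countably infinite HH-homogeneous graph all of whose vertices have infinite degree, with finite star number $\sigma(G)\geq1$ and $\alpha(G)\geq 2\sigma(G)-1$. Let $I$ be a directory of $G$. Then for all $S,T\subseteq I$ with $|S|=|T|=\sigma(G)$ and $S\cap T\neq\varnothing$, and for all $v\in K_S$, the set $N(v)\cap K_T$ is infinite.
   Context: Graphs are simple. A homomorphism maps edges to edges; an endomorphism is a homomorphism $G\to G$; $G$ is HH-homogeneous if every homomorphism between finite induced subgraphs of $G$ extends to an endomorphism of $G$. $N(v)$ is the set of neighbours of $v$. $\alpha(H)$ is the supremum of sizes of independent sets of $H$. The star number is $\sigma(G)=\sup\{\alpha(N(v)):v\in G\}$. A set $D$ dominates $X$ if $X\subseteq\bigcup_{d\in D}N(d)$; $D$ is a dominating set of $G$ if it dominates $G\setminus D$. A directory of $G$ is an independent dominating set $I$ of $G$ with $|I|=\alpha(G)$ if $\alpha(G)$ is finite, or $|I|\geq 2\sigma(G)-1$ if $\alpha(G)$ is infinite. For $S\subseteq I$, $K_S=\{v\in G: N(v)\cap I=S\}$. -}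

module Defs where

open import Level using (0ℓ)
open import Data.Nat using (ℕ; _≤_; _*_; _∸_)
open import Data.List using (List; length)
open import Data.List.Membership.Propositional using (_∈_)
open import Data.List.Relation.Unary.All using (All)
open import Data.List.Relation.Unary.Unique.Propositional using (Unique)
open import Data.Product using (Σ; ∃; _×_)
open import Data.Sum using (_⊎_)
open import Data.Empty using (⊥)
open import Relation.Nullary using (¬_)
open import Relation.Unary using (Pred; _⊆_)
open import Relation.Binary.PropositionalEquality using (_≡_)
open import Function.Bundles using (_⇔_)

-- A simple graph whose vertex set is ℕ (i.e. a countably infinite graph,
-- up to isomorphism).
record Graph : Set₁ where
  field
    Adj    : ℕ → ℕ → Set
    sym    : ∀ {x y} → Adj x y → Adj y x
    irrefl : ∀ {x} → ¬ Adj x x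
open Graph public

VSet : Set₁
VSet = Pred ℕ 0ℓ

N : Graph → ℕ → VSet
N G v w = Adj G v w

Finite : VSet → Set
Finite P = Σ (List ℕ) λ xs → ∀ x → P x → x ∈ xs

Infinite : VSet → Set
Infinite P = ¬ Finite P

HasSize : VSet → ℕ → Set
HasSize P n = Σ (List ℕ) λ xs → Unique xs × length xs ≡ n × (∀ x → x ∈ xs ⇔ P x)

AtLeast : VSet → ℕ → Set
AtLeast P n = Σ (List ℕ) λ xs → Unique xs × length xs ≡ n × All P xs

Independent : Graph → VSet → Set
Independent G P = ∀ x y → P x → P y → ¬ Adj G x y

IndepList : Graph → List ℕ → Set
IndepList G xs = ∀ x y → x ∈ xs → y ∈ xs → ¬ Adj G x y

HasIndep : Graph → VSet → ℕ → Set
HasIndep G P n = Σ (List ℕ) λ xs →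
  Unique xs × length xs ≡ n × All P xs × IndepList G xs

AlphaIs : Graph → VSet → ℕ → Set
AlphaIs G P a =
  (∀ n → HasIndep G P n → n ≤ a) ×
  (∀ t → (∀ n → HasIndep G P n → n ≤ t) → a ≤ t)

AlphaInfinite : Graph → VSet → Set
AlphaInfinite G P = ∀ n → HasIndep G P n

AlphaAtLeast : Graph → VSet → ℕ → Set
AlphaAtLeast G P n = HasIndep G P n

All-V : VSet
All-V _ = Data.Unit.⊤
  where import Data.Unit

StarNumberIs : Graph → ℕ → Set
StarNumberIs G s =
  (∀ v n → HasIndep G (N G v) n → n ≤ s) ×
  (∀ t → (∀ v n → HasIndep G (N G v) n → n ≤ t) → s ≤ t)

Dominates : Graph → VSet → VSet → Set
Dominates G D X = ∀ x → X x → ∃ λ d → D d × Adj G d x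

DominatingSet : Graph → VSet → Set
DominatingSet G D = Dominates G D (λ x → ¬ D x)

-- I is a directory of G, where s = σ(G) (finite).
Directory : Graph → ℕ → VSet → Set
Directory G s I =
  Independent G I × DominatingSet G I ×
  ((Σ ℕ λ a → AlphaIs G All-V a × HasSize I a) ⊎
   (AlphaInfinite G All-V × AtLeast I (2 * s ∸ 1)))

K : Graph → VSet → VSet → VSet
K G I S v = ∀ w → (I w × Adj G v w) ⇔ S w

-- HH-homogeneity: every homomorphism between finite induced subgraphs
-- (domain A, codomain B, both finite; the map is given by a function
-- ℕ → ℕ whose values off A are irrelevant) extends to an endomorphism.
IsEndomorphism : Graph → (ℕ → ℕ) → Set
IsEndomorphism G h = ∀ x y → Adj G x y → Adj G (h x) (h y)

IsHomFinite : Graph → List ℕ → List ℕ → (ℕ → ℕ) → Set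
IsHomFinite G A B f =
  (∀ x → x ∈ A → f x ∈ B) ×
  (∀ x y → x ∈ A → y ∈ A → Adj G x y → Adj G (f x) (f y))

HH-homogeneous : Graph → Set
HH-homogeneous G = ∀ (A B : List ℕ) (f : ℕ → ℕ) → IsHomFinite G A B f →
  Σ (ℕ → ℕ) λ h → IsEndomorphism G h × (∀ x → x ∈ A → h x ≡ f x)

{-# OPTIONS --safe #-}
-- Suppose N(v) ∩ K_T were finite; classically it is then enumerated by a list F. Call a neighbour p
-- of v a candidate if p ∉ S ∪ F and p has at most one neighbour in S. No candidate exists: p must
-- have a neighbour x* ∈ S (otherwise S ∪ {p} is an independent set of σ + 1 neighbours of v), and
-- by HH-homogeneity the finite homomorphism p ↦ v, x* ↦ w₀, S ↠ T, identity on F, extends to an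
-- endomorphism; the image c of v is adjacent to v and to all of T, so c ∈ N(v) ∩ K_T = F, yet c is
-- adjacent to its own image c.
-- Candidates do exist, however. If σ = 1 any neighbour of v outside S ∪ F will do. Otherwise
-- |I| ≥ 2σ − 1 yields σ − 1 vertices J ⊆ I ∖ S, and extending a map of S onto {v} ∪ J makes the
-- image of v a neighbour of v seeing J, which by the star bound has at most one neighbour in S.
-- It avoids F either because J contains a vertex outside T, or, when I ⊆ S ∪ T, because then
-- S ∩ T = {w₀}, J = T ∖ S and the map can fix F pointwise.
module Submission where

open import Defs
open import Data.Nat using (ℕ; suc; _+_; _*_; _∸_; _≤_; _<_; _≟_; z≤n; s≤s; s≤s⁻¹)
open import Data.Nat.Properties
  using (≤-trans; ≤-reflexive; ≤-antisym; <-irrefl; n≮n; +-cancelˡ-≤; +-suc; +-identityʳ;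
         m≤n⇒m⊓n≡m; n≢0⇒n>0; module ≤-Reasoning)
open import Data.List using (List; []; _∷_; length; filter; _++_; map; take)
open import Data.List.Properties using (filter-notAll; length-++; length-take)
open import Data.List.Membership.Propositional using (_∈_; _∉_; find; lose)
open import Data.List.Membership.Propositional.Properties
  using (∈-filter⁺; ∈-filter⁻; ∈-++⁻; ∈-++⁺ˡ; ∈-++⁺ʳ; ∈-map⁺)
open import Data.List.Membership.DecPropositional _≟_ using (_∈?_)
open import Data.List.Relation.Binary.Subset.Propositional using () renaming (_⊆_ to _⊆ₗ_)
open import Data.List.Relation.Binary.Subset.Propositional.Properties using (⊆-trans; ++⁺ʳ; xs⊆xs++ys)
open import Data.List.Relation.Unary.Any as Any using (here; there; any?)
open import Data.List.Relation.Unary.All as All using (All)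
open import Data.List.Relation.Unary.AllPairs using (_∷_)
open import Data.List.Relation.Unary.Unique.Propositional using (Unique)
open import Data.List.Relation.Unary.Unique.Propositional.Properties using (filter⁺; take⁺)
open import Data.Product using (∃; _×_; _,_; proj₁; proj₂)
open import Data.Sum using (inj₁; inj₂; [_,_]′)
open import Data.Empty using (⊥)
open import Function using (_∘_)
open import Relation.Nullary using (¬_; yes; no; ¬?; contradiction)
open import Relation.Nullary.Decidable using (decidable-stable; ¬¬-excluded-middle)
open import Relation.Unary using (_⊆_)
open import Relation.Binary.PropositionalEquality
  using (_≡_; _≢_; refl; trans; subst; subst₂; cong) renaming (sym to ≡-sym)
open import Function.Bundles using (Equivalence; _⇔_; mk⇔)
open Equivalence using (to; from)

private variable
  n x y z : ℕ
  xs ys : List ℕ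

∷-unique : x ∉ xs → Unique xs → Unique (x ∷ xs)
∷-unique {xs = xs} x∉xs u = All.tabulate (λ y∈xs x≡y → x∉xs (subst (_∈ xs) (≡-sym x≡y) y∈xs)) ∷ u

infixl 6 _∖_
_∖_ : List ℕ → List ℕ → List ℕ
xs ∖ ys = filter (λ x → ¬? (x ∈? ys)) xs

∈-∖⁺ : x ∈ xs → x ∉ ys → x ∈ xs ∖ ys
∈-∖⁺ {ys = ys} = ∈-filter⁺ (λ x → ¬? (x ∈? ys))

∈-∖⁻ : ∀ xs → x ∈ xs ∖ ys → x ∈ xs × x ∉ ys
∈-∖⁻ {ys = ys} xs = ∈-filter⁻ (λ x → ¬? (x ∈? ys)) {xs = xs}

∖-unique : Unique xs → Unique (xs ∖ ys)
∖-unique {ys = ys} = filter⁺ (λ x → ¬? (x ∈? ys))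

⊆-++-∖ : ∀ xs → xs ⊆ₗ ys ++ xs ∖ ys
⊆-++-∖ {ys} xs {x} x∈ with x ∈? ys
... | yes x∈ys = ∈-++⁺ˡ x∈ys
... | no x∉ys = ∈-++⁺ʳ ys (∈-∖⁺ x∈ x∉ys)

remove : ℕ → List ℕ → List ℕ
remove x = filter (λ y → ¬? (y ≟ x))

∈-remove⁺ : y ∈ xs → y ≢ x → y ∈ remove x xs
∈-remove⁺ {x = x} = ∈-filter⁺ (λ y → ¬? (y ≟ x))

∈-remove⁻ : ∀ xs → y ∈ remove x xs → y ∈ xs × y ≢ x
∈-remove⁻ {x = x} xs = ∈-filter⁻ (λ y → ¬? (y ≟ x)) {xs = xs}

remove-unique : Unique xs → Unique (remove x xs)
remove-unique {x = x} = filter⁺ (λ y → ¬? (y ≟ x))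

length-remove : x ∈ xs → length (remove x xs) < length xs
length-remove {x} {xs} = filter-notAll (λ y → ¬? (y ≟ x)) xs ∘ Any.map (λ x≡y y≢x → y≢x (≡-sym x≡y))

Unique-length-≤ : Unique xs → xs ⊆ₗ ys → length xs ≤ length ys
Unique-length-≤ {[]} _ _ = z≤n
Unique-length-≤ {x ∷ xs} {ys} (x∉xs ∷ u) xs⊆ys =
  ≤-trans (s≤s (Unique-length-≤ u xs⊆rest)) (length-remove (xs⊆ys (here refl)))
  where
  xs⊆rest : xs ⊆ₗ remove x ys
  xs⊆rest y∈xs = ∈-remove⁺ (xs⊆ys (there y∈xs)) (λ y≡x → All.lookup x∉xs y∈xs (≡-sym y≡x))

moveToFront : ℕ → List ℕ → List ℕ
moveToFront x xs = x ∷ remove x xs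

moveToFront-⊇ : ∀ {x xs} → xs ⊆ₗ moveToFront x xs
moveToFront-⊇ {x} {_} {y} y∈xs with y ≟ x
... | yes y≡x = here y≡x
... | no y≢x = there (∈-remove⁺ y∈xs y≢x)

moveToFront-⊆ : ∀ {x xs} → x ∈ xs → moveToFront x xs ⊆ₗ xs
moveToFront-⊆ x∈xs (here refl) = x∈xs
moveToFront-⊆ {xs = xs} _ (there y∈) = proj₁ (∈-remove⁻ xs y∈)

moveToFront-unique : ∀ {xs x} → Unique xs → Unique (moveToFront x xs)
moveToFront-unique {xs} u = ∷-unique (λ x∈ → proj₂ (∈-remove⁻ xs x∈) refl) (remove-unique u)

length-moveToFront : Unique xs → x ∈ xs → length (moveToFront x xs) ≡ length xs
length-moveToFront u x∈xs = ≤-antisym (length-remove x∈xs) (Unique-length-≤ u moveToFront-⊇)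

∈-take⁻ : ∀ n → x ∈ take n xs → x ∈ xs
∈-take⁻ {xs = _ ∷ _} (suc n) (here x≡y) = here x≡y
∈-take⁻ {xs = _ ∷ _} (suc n) (there x∈) = there (∈-take⁻ n x∈)

∈-take-head : 1 ≤ n → x ∈ take n (x ∷ xs)
∈-take-head (s≤s _) = here refl

take-atLeast : ∀ {P : VSet} n → Unique xs → All P xs → n ≤ length xs → AtLeast P n
take-atLeast {xs = xs} n u all n≤ =
  take n xs , take⁺ n u , trans (length-take n xs) (m≤n⇒m⊓n≡m n≤) , All.tabulate (All.lookup all ∘ ∈-take⁻ n)

singleton-≡ : length xs ≡ 1 → x ∈ xs → y ∈ xs → x ≡ y
singleton-≡ {_ ∷ []} _ (here x≡z) (here y≡z) = trans x≡z (≡-sym y≡z)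

zipMap : List ℕ → List ℕ → ℕ → ℕ
zipMap (x ∷ xs) (y ∷ ys) z with z ≟ x
... | yes _ = y
... | no _ = zipMap xs ys z
zipMap _ _ z = z

zipMap-head : zipMap (x ∷ xs) (y ∷ ys) x ≡ y
zipMap-head {x} with x ≟ x
... | yes _ = refl
... | no x≢x = contradiction refl x≢x

zipMap-tail : z ≢ x → zipMap (x ∷ xs) (y ∷ ys) z ≡ zipMap xs ys z
zipMap-tail {z} {x} z≢x with z ≟ x
... | yes z≡x = contradiction z≡x z≢x
... | no _ = refl

zipMap-fresh : z ∉ xs → zipMap xs ys z ≡ z
zipMap-fresh {xs = []} _ = refl
zipMap-fresh {xs = _ ∷ _} {ys = []} _ = refl
zipMap-fresh {z} {x ∷ xs} {_ ∷ _} z∉ with z ≟ x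
... | yes z≡x = contradiction (here z≡x) z∉
... | no _ = zipMap-fresh (z∉ ∘ there)

zipMap-∈ : length xs ≤ length ys → z ∈ xs → zipMap xs ys z ∈ ys
zipMap-∈ {x ∷ xs} {_ ∷ _} {z} (s≤s le) z∈ with z ≟ x
... | yes _ = here refl
... | no z≢x = there (zipMap-∈ le (Any.tail z≢x z∈))

zipMap-onto : Unique xs → length ys ≤ length xs → y ∈ ys → ∃ λ x → x ∈ xs × zipMap xs ys x ≡ y
zipMap-onto {x ∷ xs} {_ ∷ ys} _ _ (here refl) = x , here refl , zipMap-head {x = x} {xs = xs} {ys = ys}
zipMap-onto {x ∷ _} {_ ∷ _} (x∉xs ∷ u) (s≤s le) (there y∈) with zipMap-onto u le y∈
... | x′ , x′∈ , eq = x′ , there x′∈ , trans (zipMap-tail (λ x′≡x → All.lookup x∉xs x′∈ (≡-sym x′≡x))) eq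

Finite⇒¬¬enumerated : {P : VSet} → Finite P →
  ¬ ¬ (∃ λ F → (∀ {y} → y ∈ F → P y) × (∀ {y} → P y → y ∈ F))
Finite⇒¬¬enumerated {P} (L , L⊇P) k =
  ¬¬-filter L λ (F , sound , complete) → k (F , sound , λ py → complete (L⊇P _ py) py)
  where
  ¬¬-filter : ∀ L → ¬ ¬ (∃ λ F → (∀ {y} → y ∈ F → P y) × (∀ {y} → y ∈ L → P y → y ∈ F))
  ¬¬-filter [] k = k ([] , (λ ()) , λ ())
  ¬¬-filter (x ∷ L) k = ¬¬-filter L λ (F , sound , complete) → ¬¬-excluded-middle λ
    { (yes px) → k (x ∷ F , (λ { (here refl) → px ; (there y∈F) → sound y∈F })
                          , λ { (here refl) _ → here refl ; (there y∈L) py → there (complete y∈L py) })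
    ; (no ¬px) → k (F , sound , λ { (here refl) py → contradiction py ¬px ; (there y∈L) → complete y∈L }) }

Infinite⇒¬¬outside : {P : VSet} → Infinite P → (M : List ℕ) → ¬ ¬ (∃ λ p → P p × p ∉ M)
Infinite⇒¬¬outside inf M k = inf (M , λ x px → decidable-stable (x ∈? M) (λ x∉M → k (x , px , x∉M)))

HomOn : Graph → (ℕ → ℕ) → List ℕ → Set
HomOn G f A = ∀ {x y} → x ∈ A → y ∈ A → Adj G x y → Adj G (f x) (f y)

AtMostOneNeighbourIn : Graph → ℕ → List ℕ → Set
AtMostOneNeighbourIn G p xs = ∀ {x y} → x ∈ xs → y ∈ xs → Adj G p x → Adj G p y → x ≡ y

module Homomorphisms (G : Graph) where

  HomOn-identity : ∀ {f A} → (∀ {x} → x ∈ A → f x ≡ x) → HomOn G f A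
  HomOn-identity f≗id x∈ y∈ = subst₂ (Adj G) (≡-sym (f≗id x∈)) (≡-sym (f≗id y∈))

  HomOn-∷ : ∀ {f p A} → HomOn G f A → (∀ {y} → y ∈ A → Adj G p y → Adj G (f p) (f y)) → HomOn G f (p ∷ A)
  HomOn-∷ _ _ (here refl) (here refl) p~p = contradiction p~p (irrefl G)
  HomOn-∷ _ hp (here refl) (there y∈) = hp y∈
  HomOn-∷ _ hp (there x∈) (here refl) = sym G ∘ hp x∈ ∘ sym G
  HomOn-∷ hom _ (there x∈) (there y∈) = hom x∈ y∈

  HomOn-++ : ∀ {f A B} → HomOn G f A → HomOn G f B →
    (∀ {x y} → x ∈ A → y ∈ B → Adj G x y → Adj G (f x) (f y)) → HomOn G f (A ++ B)
  HomOn-++ {A = A} homA homB across x∈ y∈ with ∈-++⁻ A x∈ | ∈-++⁻ A y∈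
  ... | inj₁ x∈A | inj₁ y∈A = homA x∈A y∈A
  ... | inj₁ x∈A | inj₂ y∈B = across x∈A y∈B
  ... | inj₂ x∈B | inj₁ y∈A = sym G ∘ across y∈A x∈B ∘ sym G
  ... | inj₂ x∈B | inj₂ y∈B = homB x∈B y∈B

  hh-commonNeighbour : HH-homogeneous G → ∀ {f A z} → HomOn G f A → (∀ {x} → x ∈ A → Adj G z x) →
    ∃ λ c → ∀ {x} → x ∈ A → Adj G c (f x)
  hh-commonNeighbour hh {f} {A} {z} hom z~A with hh A (map f A) f ((λ _ → ∈-map⁺ f) , λ _ _ → hom)
  ... | h , endo , h≗f = h z , λ x∈ → subst (Adj G (h z)) (h≗f _ x∈) (endo _ _ (z~A x∈))

module StarBounded (G : Graph) {b : ℕ} (star : ∀ x n → HasIndep G (N G x) n → n ≤ b) where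

  independentNeighbours-≤ : Unique xs → (∀ {y} → y ∈ xs → Adj G x y) → IndepList G xs → length xs ≤ b
  independentNeighbours-≤ {xs} {x} u adj ind = star x (length xs) (xs , u , refl , All.tabulate adj , ind)

  module InIndependentSet {I : VSet} (indI : Independent G I) where

    neighboursInI-≤ : Unique xs → (∀ {y} → y ∈ xs → Adj G x y) → (∀ {y} → y ∈ xs → I y) → length xs ≤ b
    neighboursInI-≤ u adj xs⊆I = independentNeighbours-≤ u adj λ _ _ y∈ z∈ → indI _ _ (xs⊆I y∈) (xs⊆I z∈)

    adjacentToAll⇒K : {T : VSet} → T ⊆ I → HasSize T b → ∀ {c} → (∀ {t} → T t → Adj G c t) → K G I T c
    adjacentToAll⇒K {T} T⊆I (Tl , uT , lT , Tl⇔T) {c} c~T w = mk⇔ in-T (λ tw → T⊆I tw , c~T tw)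
      where
      in-T : I w × Adj G c w → T w
      in-T (Iw , c~w) with w ∈? Tl
      ... | yes w∈Tl = to (Tl⇔T w) w∈Tl
      ... | no w∉Tl = contradiction (neighboursInI-≤ (∷-unique w∉Tl uT) adj inI) (<-irrefl lT)
        where
        adj : ∀ {y} → y ∈ w ∷ Tl → Adj G c y
        adj (here refl) = c~w
        adj (there y∈) = c~T (to (Tl⇔T _) y∈)
        inI : ∀ {y} → y ∈ w ∷ Tl → I y
        inI (here refl) = Iw
        inI (there y∈) = T⊆I (to (Tl⇔T _) y∈)

    atMostOneNeighbour : ∀ {p} (S J : List ℕ) → (∀ {x} → x ∈ S → I x) →
      Unique J → (∀ {x} → x ∈ J → I x × x ∉ S) → b ≤ suc (length J) →
      (∀ {x} → x ∈ J → Adj G p x) → AtMostOneNeighbourIn G p S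
    atMostOneNeighbour {p} S J S⊆I uJ J-out b≤ p~J {x} {y} x∈S y∈S p~x p~y with x ≟ y
    ... | yes x≡y = x≡y
    ... | no x≢y = contradiction (≤-trans (neighboursInI-≤ xyJ-unique adj inI) b≤) (n≮n _)
      where
      J∌ : ∀ {z} → z ∈ S → z ∉ J
      J∌ z∈S z∈J = proj₂ (J-out z∈J) z∈S
      xyJ-unique : Unique (x ∷ y ∷ J)
      xyJ-unique = ∷-unique (λ { (here x≡y) → x≢y x≡y ; (there x∈J) → J∌ x∈S x∈J }) (∷-unique (J∌ y∈S) uJ)
      adj : ∀ {z} → z ∈ x ∷ y ∷ J → Adj G p z
      adj (here refl) = p~x
      adj (there (here refl)) = p~y
      adj (there (there z∈)) = p~J z∈
      inI : ∀ {z} → z ∈ x ∷ y ∷ J → I z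
      inI (here refl) = S⊆I x∈S
      inI (there (here refl)) = S⊆I y∈S
      inI (there (there z∈)) = proj₁ (J-out z∈)

directory-atLeast : ∀ {G s I} → Directory G s I → AlphaAtLeast G All-V (2 * s ∸ 1) → AtLeast I (2 * s ∸ 1)
directory-atLeast (_ , _ , inj₁ (_ , (α-max , _) , Il , uI , lI , Il⇔I)) α≥ =
  take-atLeast _ uI (All.tabulate (to (Il⇔I _))) (subst (_ ≤_) (≡-sym lI) (α-max _ α≥))
directory-atLeast (_ , _ , inj₂ (_ , |I|≥)) _ = |I|≥

2*suc∸1 : ∀ n → 2 * suc n ∸ 1 ≡ suc n + n
2*suc∸1 n = trans (+-suc n (n + 0)) (cong (suc ∘ (n +_)) (+-identityʳ n))

module NoFiniteEnumeration
  {G : Graph} (hh : HH-homogeneous G) (infdeg : ∀ v → Infinite (N G v)) (s′ : ℕ)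
  (star : ∀ x n → HasIndep G (N G x) n → n ≤ suc s′)
  {I : VSet} (indI : Independent G I)
  (Il : List ℕ) (Il-unique : Unique Il) (Il-length : length Il ≡ 2 * suc s′ ∸ 1) (Il⊆I : All I Il)
  {S T : VSet} (S⊆I : S ⊆ I) (T⊆I : T ⊆ I)
  (Sl : List ℕ) (Sl-unique : Unique Sl) (Sl-length : length Sl ≡ suc s′) (Sl⇔S : ∀ x → x ∈ Sl ⇔ S x)
  (Tl : List ℕ) (Tl-unique : Unique Tl) (Tl-length : length Tl ≡ suc s′) (Tl⇔T : ∀ x → x ∈ Tl ⇔ T x)
  {w₀ : ℕ} (w₀∈S : S w₀) (w₀∈T : T w₀) {v : ℕ} (v∈K : K G I S v)
  {F : List ℕ} (F-sound : ∀ {y} → y ∈ F → Adj G v y × K G I T y)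
  (F-complete : ∀ {y} → Adj G v y × K G I T y → y ∈ F)
  where
  -- σ = suc s′

  open Homomorphisms G
  open StarBounded G star
  open InIndependentSet indI

  private
    _~_ : ℕ → ℕ → Set
    _~_ = Adj G

  Sl⊆I : x ∈ Sl → I x
  Sl⊆I x∈ = S⊆I (to (Sl⇔S _) x∈)

  Tl⊆I : x ∈ Tl → I x
  Tl⊆I x∈ = T⊆I (to (Tl⇔T _) x∈)

  w₀∈Sl : w₀ ∈ Sl
  w₀∈Sl = from (Sl⇔S _) w₀∈S

  w₀∈Tl : w₀ ∈ Tl
  w₀∈Tl = from (Tl⇔T _) w₀∈T

  v~Sl : x ∈ Sl → v ~ x
  v~Sl x∈ = proj₂ (from (v∈K _) (to (Sl⇔S _) x∈))

  K⇒adj : K G I T y → x ∈ Tl → y ~ x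
  K⇒adj yK x∈ = proj₂ (from (yK _) (to (Tl⇔T _) x∈))

  K-adj⇒∈Tl : K G I T y → I x → y ~ x → x ∈ Tl
  K-adj⇒∈Tl yK Ix y~x = from (Tl⇔T _) (to (yK _) (Ix , y~x))

  adj-I⇒∉Sl : I x → y ~ x → y ∉ Sl
  adj-I⇒∉Sl Ix y~x y∈Sl = indI _ _ (Sl⊆I y∈Sl) Ix y~x

  F∩Sl≡∅ : y ∈ F → y ∉ Sl
  F∩Sl≡∅ y∈F = adj-I⇒∉Sl (Tl⊆I w₀∈Tl) (K⇒adj (proj₂ (F-sound y∈F)) w₀∈Tl)

  v~Sl++F : x ∈ Sl ++ F → v ~ x
  v~Sl++F x∈ = [ v~Sl , proj₁ ∘ F-sound ]′ (∈-++⁻ Sl x∈)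

  Sl-hom : ∀ f → HomOn G f Sl
  Sl-hom _ x∈ y∈ x~y = contradiction x~y (indI _ _ (Sl⊆I x∈) (Sl⊆I y∈))

  candidate-sees-Sl : ∀ {p} → v ~ p → p ∉ Sl → ¬ (∀ {x} → x ∈ Sl → ¬ p ~ x)
  candidate-sees-Sl {p} v~p p∉Sl p≁Sl =
    <-irrefl Sl-length (independentNeighbours-≤ (∷-unique p∉Sl Sl-unique) adj ind)
    where
    adj : ∀ {y} → y ∈ p ∷ Sl → v ~ y
    adj (here refl) = v~p
    adj (there y∈) = v~Sl y∈
    ind : IndepList G (p ∷ Sl)
    ind _ _ (here refl) (here refl) = irrefl G
    ind _ _ (here refl) (there y∈) = p≁Sl y∈
    ind _ _ (there x∈) (here refl) = p≁Sl x∈ ∘ sym G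
    ind _ _ (there x∈) (there y∈) = indI _ _ (Sl⊆I x∈) (Sl⊆I y∈)

  module MatchingSlToTl {p x* : ℕ} (p∉Sl : p ∉ Sl) (p∉F : p ∉ F) (x*∈Sl : x* ∈ Sl) where

    Sl* Tl* : List ℕ
    Sl* = moveToFront x* Sl
    Tl* = moveToFront w₀ Tl

    f : ℕ → ℕ
    f = zipMap (p ∷ Sl*) (v ∷ Tl*)

    Sl*≡Tl* : length Sl* ≡ length Tl*
    Sl*≡Tl* = trans (length-moveToFront Sl-unique x*∈Sl)
              (trans Sl-length (≡-sym (trans (length-moveToFront Tl-unique w₀∈Tl) Tl-length)))

    f-p : f p ≡ v
    f-p = zipMap-head {x = p} {xs = Sl*} {ys = Tl*}

    f-Sl : ∀ {x} → x ∈ Sl → f x ≡ zipMap Sl* Tl* x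
    f-Sl {x} x∈ = zipMap-tail {z = x} {x = p} {xs = Sl*} {ys = Tl*} λ { refl → p∉Sl x∈ }

    f-x* : f x* ≡ w₀
    f-x* = trans (f-Sl x*∈Sl) (zipMap-head {x = x*} {xs = remove x* Sl} {ys = remove w₀ Tl})

    f-Sl⊆Tl : x ∈ Sl → f x ∈ Tl
    f-Sl⊆Tl x∈ = subst (_∈ Tl) (≡-sym (f-Sl x∈))
      (moveToFront-⊆ w₀∈Tl (zipMap-∈ (≤-reflexive Sl*≡Tl*) (moveToFront-⊇ x∈)))

    f-onto : ∀ {t} → t ∈ Tl → ∃ λ x → x ∈ Sl × f x ≡ t
    f-onto t∈ with zipMap-onto (moveToFront-unique Sl-unique) (≤-reflexive (≡-sym Sl*≡Tl*)) (moveToFront-⊇ t∈)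
    ... | x , x∈ , fx≡t = x , moveToFront-⊆ x*∈Sl x∈ , trans (f-Sl (moveToFront-⊆ x*∈Sl x∈)) fx≡t

    f-F : y ∈ F → f y ≡ y
    f-F y∈F = zipMap-fresh λ { (here refl) → p∉F y∈F ; (there y∈) → F∩Sl≡∅ y∈F (moveToFront-⊆ x*∈Sl y∈) }

    f-hom : p ~ x* → AtMostOneNeighbourIn G p Sl → HomOn G f (p ∷ Sl ++ F)
    f-hom p~x* p~≤1 = HomOn-∷ (HomOn-++ (Sl-hom f) (HomOn-identity f-F) Sl-F-edges) p-edges
      where
      p-edges : ∀ {y} → y ∈ Sl ++ F → p ~ y → f p ~ f y
      p-edges y∈ p~y with ∈-++⁻ Sl y∈
      ... | inj₁ y∈Sl = subst₂ _~_ (≡-sym f-p) (≡-sym (trans (cong f (p~≤1 y∈Sl x*∈Sl p~y p~x*)) f-x*))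
                          (v~Sl w₀∈Sl)
      ... | inj₂ y∈F = subst₂ _~_ (≡-sym f-p) (≡-sym (f-F y∈F)) (proj₁ (F-sound y∈F))

      Sl-F-edges : ∀ {x y} → x ∈ Sl → y ∈ F → x ~ y → f x ~ f y
      Sl-F-edges {x} x∈ y∈ _ = subst (f x ~_) (≡-sym (f-F y∈)) (sym G (K⇒adj (proj₂ (F-sound y∈)) (f-Sl⊆Tl x∈)))

  no-candidate-seeing-Sl : ∀ {p x*} → v ~ p → p ∉ Sl → p ∉ F → AtMostOneNeighbourIn G p Sl →
    x* ∈ Sl → p ~ x* → ⊥
  no-candidate-seeing-Sl {p} v~p p∉Sl p∉F p~≤1 x*∈Sl p~x* =
    irrefl G (subst (c ~_) (f-F c∈F) (c~fA (there (∈-++⁺ʳ Sl c∈F))))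
    where
    open MatchingSlToTl p∉Sl p∉F x*∈Sl

    image : ∃ λ c → ∀ {x} → x ∈ p ∷ Sl ++ F → c ~ f x
    image = hh-commonNeighbour hh {z = v} (f-hom p~x* p~≤1) λ { (here refl) → v~p ; (there x∈) → v~Sl++F x∈ }

    c : ℕ
    c = proj₁ image

    c~fA : ∀ {x} → x ∈ p ∷ Sl ++ F → c ~ f x
    c~fA = proj₂ image

    c~T : ∀ {t} → T t → c ~ t
    c~T Tt = let x , x∈ , fx≡t = f-onto (from (Tl⇔T _) Tt) in subst (c ~_) fx≡t (c~fA (there (∈-++⁺ˡ x∈)))

    c∈F : c ∈ F
    c∈F = F-complete (sym G (subst (c ~_) f-p (c~fA (here refl))) ,
                      adjacentToAll⇒K T⊆I (Tl , Tl-unique , Tl-length , Tl⇔T) c~T)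

  no-candidate : ∀ {p} → v ~ p → p ∉ Sl → p ∉ F → AtMostOneNeighbourIn G p Sl → ⊥
  no-candidate {p} v~p p∉Sl p∉F p~≤1 = ¬¬-excluded-middle {A = ∃ λ x → x ∈ Sl × p ~ x} λ
    { (yes (_ , x∈ , p~x)) → no-candidate-seeing-Sl v~p p∉Sl p∉F p~≤1 x∈ p~x
    ; (no p≁Sl) → candidate-sees-Sl v~p p∉Sl λ x∈ p~x → p≁Sl (_ , x∈ , p~x) }

  σ≡1-impossible : s′ ≡ 0 → ⊥
  σ≡1-impossible s′≡0 = Infinite⇒¬¬outside (infdeg v) (Sl ++ F) λ (p , v~p , p∉) →
    no-candidate v~p (p∉ ∘ ∈-++⁺ˡ) (p∉ ∘ ∈-++⁺ʳ Sl)
      λ x∈ y∈ _ _ → singleton-≡ (trans Sl-length (cong suc s′≡0)) x∈ y∈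

  OutsideS : VSet
  OutsideS x = I x × x ∉ Sl

  ∖Sl-outside : (∀ {x} → x ∈ xs → I x) → x ∈ xs ∖ Sl → OutsideS x
  ∖Sl-outside {xs} xs⊆I x∈ = let x∈xs , x∉Sl = ∈-∖⁻ xs x∈ in xs⊆I x∈xs , x∉Sl

  no-neighbour-seeing-OutsideS : ∀ {p} → 1 ≤ s′ → v ~ p → p ∉ F → (J : List ℕ) → Unique J → length J ≡ s′ →
    (∀ {x} → x ∈ J → OutsideS x) → (∀ {x} → x ∈ J → p ~ x) → ⊥
  no-neighbour-seeing-OutsideS 1≤s′ _ _ [] _ lJ _ _ = contradiction (subst (1 ≤_) (≡-sym lJ) 1≤s′) λ ()
  no-neighbour-seeing-OutsideS _ v~p p∉F J@(_ ∷ _) uJ lJ J-out p~J =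
    no-candidate v~p (adj-I⇒∉Sl (proj₁ (J-out (here refl))) (p~J (here refl))) p∉F
      (atMostOneNeighbour Sl J Sl⊆I uJ J-out (s≤s (≤-reflexive (≡-sym lJ))) p~J)

  remainder-length : ∀ {M} → Il ⊆ₗ Sl ++ M → s′ ≤ length M
  remainder-length {M} Il⊆ = +-cancelˡ-≤ (suc s′) s′ (length M) (begin
    suc s′ + s′            ≡⟨ ≡-sym (2*suc∸1 s′) ⟩
    2 * suc s′ ∸ 1         ≡⟨ ≡-sym Il-length ⟩
    length Il              ≤⟨ Unique-length-≤ Il-unique Il⊆ ⟩
    length (Sl ++ M)       ≡⟨ length-++ Sl ⟩
    length Sl + length M   ≡⟨ cong (_+ length M) Sl-length ⟩
    suc s′ + length M      ∎)
    where open ≤-Reasoning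

  outside-S∪T-impossible : 1 ≤ s′ → ∀ {j} → j ∈ Il → j ∉ Sl → j ∉ Tl → ⊥
  outside-S∪T-impossible 1≤s′ {j} j∈Il j∉Sl j∉Tl =
    no-neighbour-seeing-OutsideS 1≤s′ (sym G (p~vJ (here refl))) p∉F J uJ lJ J-out (p~vJ ∘ there)
    where
    J : List ℕ
    J = take s′ (moveToFront j (Il ∖ Sl))

    uJ : Unique J
    uJ = take⁺ s′ (moveToFront-unique (∖-unique Il-unique))

    lJ : length J ≡ s′
    lJ = trans (length-take s′ _) (m≤n⇒m⊓n≡m (remainder-length (⊆-trans (⊆-++-∖ Il) (++⁺ʳ Sl moveToFront-⊇))))

    J-out : ∀ {x} → x ∈ J → OutsideS x
    J-out = ∖Sl-outside (All.lookup Il⊆I) ∘ moveToFront-⊆ (∈-∖⁺ j∈Il j∉Sl) ∘ ∈-take⁻ s′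

    image : ∃ λ p → ∀ {x} → x ∈ Sl → p ~ zipMap Sl (v ∷ J) x
    image = hh-commonNeighbour hh {z = v} (Sl-hom (zipMap Sl (v ∷ J))) v~Sl

    p~vJ : ∀ {y} → y ∈ v ∷ J → proj₁ image ~ y
    p~vJ y∈ with zipMap-onto Sl-unique (≤-reflexive (trans (cong suc lJ) (≡-sym Sl-length))) y∈
    ... | x , x∈ , fx≡y = subst (proj₁ image ~_) fx≡y (proj₂ image x∈)

    p∉F : proj₁ image ∉ F
    p∉F p∈F = j∉Tl (K-adj⇒∈Tl (proj₂ (F-sound p∈F)) (All.lookup Il⊆I j∈Il) (p~vJ (there (∈-take-head 1≤s′))))

  module CoveredByS∪T (Il⊆Sl++Tl : Il ⊆ₗ Sl ++ Tl) where

    J : List ℕ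
    J = Tl ∖ Sl

    J-unique : Unique J
    J-unique = ∖-unique Tl-unique

    s′≤J : s′ ≤ length J
    s′≤J = remainder-length λ x∈ → [ xs⊆xs++ys Sl J , ⊆-++-∖ Tl ]′ (∈-++⁻ Sl (Il⊆Sl++Tl x∈))

    fits-in-Tl : ∀ {xs} → Unique (xs ++ J) → xs ⊆ₗ Tl → length xs + length J ≤ suc s′
    fits-in-Tl {xs} u xs⊆Tl = subst (_≤ suc s′) (length-++ xs)
      (≤-trans (Unique-length-≤ u λ x∈ → [ xs⊆Tl , proj₁ ∘ ∈-∖⁻ Tl ]′ (∈-++⁻ xs x∈)) (≤-reflexive Tl-length))

    w₀∉J : w₀ ∉ J
    w₀∉J w₀∈J = proj₂ (∈-∖⁻ Tl w₀∈J) w₀∈Sl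

    J-length : length J ≡ s′
    J-length = ≤-antisym (s≤s⁻¹ (fits-in-Tl (∷-unique w₀∉J J-unique) λ { (here refl) → w₀∈Tl })) s′≤J

    S∩T≡w₀ : ∀ {x} → x ∈ Sl → x ∈ Tl → x ≡ w₀
    S∩T≡w₀ {x} x∈Sl x∈Tl with x ≟ w₀
    ... | yes x≡w₀ = x≡w₀
    ... | no x≢w₀ = contradiction (≤-trans (s≤s (s≤s s′≤J)) (fits-in-Tl xw₀J-unique xw₀⊆Tl)) (n≮n _)
      where
      xw₀J-unique : Unique (x ∷ w₀ ∷ J)
      xw₀J-unique = ∷-unique (λ { (here x≡w₀) → x≢w₀ x≡w₀ ; (there x∈J) → proj₂ (∈-∖⁻ Tl x∈J) x∈Sl })
                             (∷-unique w₀∉J J-unique)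
      xw₀⊆Tl : x ∷ w₀ ∷ [] ⊆ₗ Tl
      xw₀⊆Tl (here refl) = x∈Tl
      xw₀⊆Tl (there (here refl)) = w₀∈Tl

    f : ℕ → ℕ
    f = zipMap (moveToFront w₀ Sl) (v ∷ J)

    f-w₀ : f w₀ ≡ v
    f-w₀ = zipMap-head {x = w₀} {xs = remove w₀ Sl} {ys = J}

    f-F : ∀ {y} → y ∈ F → f y ≡ y
    f-F y∈F = zipMap-fresh (F∩Sl≡∅ y∈F ∘ moveToFront-⊆ w₀∈Sl)

    f-hom : HomOn G f (Sl ++ F)
    f-hom = HomOn-++ (Sl-hom f) (HomOn-identity f-F) Sl-F-edges
      where
      Sl-F-edges : ∀ {x y} → x ∈ Sl → y ∈ F → x ~ y → f x ~ f y
      Sl-F-edges x∈ y∈ x~y with S∩T≡w₀ x∈ (K-adj⇒∈Tl (proj₂ (F-sound y∈)) (Sl⊆I x∈) (sym G x~y))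
      ... | refl = subst₂ _~_ (≡-sym f-w₀) (≡-sym (f-F y∈)) (proj₁ (F-sound y∈))

    impossible : 1 ≤ s′ → ⊥
    impossible 1≤s′ =
      no-neighbour-seeing-OutsideS 1≤s′ (sym G (p~vJ (here refl))) p∉F J J-unique J-length
        (∖Sl-outside Tl⊆I) (p~vJ ∘ there)
      where
      image : ∃ λ p → ∀ {x} → x ∈ Sl ++ F → p ~ f x
      image = hh-commonNeighbour hh {z = v} f-hom v~Sl++F

      vJ≡Sl : length (v ∷ J) ≡ length (moveToFront w₀ Sl)
      vJ≡Sl = trans (cong suc J-length) (≡-sym (trans (length-moveToFront Sl-unique w₀∈Sl) Sl-length))

      p~vJ : ∀ {y} → y ∈ v ∷ J → proj₁ image ~ y
      p~vJ y∈ with zipMap-onto (moveToFront-unique Sl-unique) (≤-reflexive vJ≡Sl) y∈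
      ... | x , x∈ , fx≡y = subst (proj₁ image ~_) fx≡y (proj₂ image (∈-++⁺ˡ (moveToFront-⊆ w₀∈Sl x∈)))

      p∉F : proj₁ image ∉ F
      p∉F p∈F = irrefl G (subst (proj₁ image ~_) (f-F p∈F) (proj₂ image (∈-++⁺ʳ Sl p∈F)))

  absurd : ⊥
  absurd with s′ ≟ 0
  ... | yes s′≡0 = σ≡1-impossible s′≡0
  ... | no s′≢0 with any? (λ x → ¬? (x ∈? Sl ++ Tl)) Il
  ...   | yes outside = let _ , j∈Il , j∉ = find outside in
          outside-S∪T-impossible (n≢0⇒n>0 s′≢0) j∈Il (j∉ ∘ ∈-++⁺ˡ) (j∉ ∘ ∈-++⁺ʳ Sl)
  ...   | no ¬outside = CoveredByS∪T.impossible
          (λ {x} x∈ → decidable-stable (x ∈? Sl ++ Tl) (¬outside ∘ lose x∈)) (n≢0⇒n>0 s′≢0)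

lemma15 : (G : Graph) → HH-homogeneous G →
    (∀ v → Infinite (N G v)) →
    (s : ℕ) → StarNumberIs G s → 1 ≤ s →
    AlphaAtLeast G All-V (2 * s ∸ 1) →
    (I : VSet) → Directory G s I →
    (S T : VSet) → S ⊆ I → T ⊆ I → HasSize S s → HasSize T s →
    (∃ λ w → S w × T w) →
    (v : ℕ) → K G I S v →
    Infinite (λ w → N G v w × K G I T w)
lemma15 G hh infdeg (suc s′) (star , _) (s≤s z≤n) α≥ I dir S T S⊆I T⊆I
  (Sl , uS , lS , Sl⇔S) (Tl , uT , lT , Tl⇔T) (w₀ , w₀∈S , w₀∈T) v v∈K finite =
  let Il , uI , lI , Il⊆I = directory-atLeast {G} {suc s′} {I} dir α≥ in
  Finite⇒¬¬enumerated finite λ (F , sound , complete) →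
    NoFiniteEnumeration.absurd {G} hh infdeg s′ star {I} (proj₁ dir) Il uI lI Il⊆I S⊆I T⊆I
      Sl uS lS Sl⇔S Tl uT lT Tl⇔T w₀∈S w₀∈T v∈K sound complete
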